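{- Let $(D,\mathcal T,s)$ be an instance of Linear Vertex Cut, where $\mathcal T=\{T_1,\dots,T_k\}$ consists of pairwise disjoint subsets of $V(D)$, and let $(D',\mathcal T',s)$ be the associated instance of Linear Edge Cut constructed as follows: for each $v\in V(D)$, $D'$ has vertices $v_{\mathrm{in}},v_{\mathrm{out}}$ and an edge $e_v=(v_{\mathrm{in}},v_{\mathrm{out}})$; for each edge $(u,v)\in E(D)$, $D'$ has $s+1$ parallel edges from $u_{\mathrm{out}}$ to $v_{\mathrm{in}}$; for each $i\in[k]$ and $v\in T_i$, $D'$ has a new vertex $v'$ with $s+1$ parallel edges from $v'$ to $v_{\mathrm{in}}$ and $s+1$ parallel edges from $v_{\mathrm{out}}$ to $v'$; and $T'_i=\{v' : v\in T_i\}$, $\mathcal T'=\{T'_1,\dots,T'_k\}$. Then $(D,\mathcal T,s)$ is a positive instance of Linear Vertex Cut if and only if $(D',\mathcal T',s)$ is a positive instance of Linear Edge Cut.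
   Context: Linear Vertex Cut: given a digraph $D$, a sequence $T_1,\dots,T_k$ of subsets of $V(D)$, and an integer $s\ge 0$, decide whether there is $Z\subseteq V(D)$ with $|Z|\le s$ such that $D\setminus Z$ has no directed path from a vertex of $T_i$ to a vertex of $T_j$ for any $1\le i<j\le k$. Linear Edge Cut: given a digraph (multiple edges allowed) $D'$, a sequence $T'_1,\dots,T'_k$ of vertex subsets, and an integer $s\ge0$, decide whether there is a set $Z'$ of at most $s$ edges such that $D'\setminus Z'$ has no directed path from $T'_i$ to $T'_j$ for any $1\le i<j\le k$. -}

module Defs where

open import Data.Nat using (ℕ; suc; _≤_; _<_)
open import Data.Fin using (Fin)
import Data.Fin as F
open import Data.Fin.Subset using (Subset; _∈_; _∉_; ∣_∣)
open import Data.Fin.Subset.Properties using (_∈?_)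
open import Data.List using (List; []; _∷_; _++_; map; concatMap; replicate; length; lookup)
open import Data.List using (allFin)
open import Data.List.Membership.Propositional using () renaming (_∈_ to _∈ₗ_)
open import Data.Product using (Σ; ∃; ∃-syntax; _×_; _,_)
open import Relation.Binary.PropositionalEquality using (_≡_; _≢_)
open import Relation.Nullary using (¬_; yes; no)
open import Data.Empty using (⊥)

data VReach {n : ℕ} (E : List (Fin n × Fin n)) (Z : Subset n) : Fin n → Fin n → Set where
  here : ∀ {a} → a ∉ Z → VReach E Z a a
  step : ∀ {a b c} → a ∉ Z → (a , b) ∈ₗ E → VReach E Z b c → VReach E Z a c

VSeparates : {n k : ℕ} → List (Fin n × Fin n) → (Fin k → Subset n) → Subset n → Set
VSeparates {n} {k} E T Z =
  ∀ (i j : Fin k) → i F.< j → ∀ (a b : Fin n) → a ∈ T i → b ∈ T j → ¬ VReach E Z a b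

LinearVertexCut : {n k : ℕ} → List (Fin n × Fin n) → (Fin k → Subset n) → ℕ → Set
LinearVertexCut {n} E T s = Σ (Subset n) λ Z → ∣ Z ∣ ≤ s × VSeparates E T Z

-- Linear Edge Cut on a multidigraph: vertex type V, edge list E
-- (parallel edges = repeated entries, each edge identified by its position).

data EReach {V : Set} (E : List (V × V)) (Z : Subset (length E)) : V → V → Set where
  here : ∀ {a} → EReach E Z a a
  step : ∀ {a b c} (e : Fin (length E)) → e ∉ Z → lookup E e ≡ (a , b) →
         EReach E Z b c → EReach E Z a c

ESeparates : {V : Set} {k : ℕ} (E : List (V × V)) → (Fin k → V → Set) → Subset (length E) → Set
ESeparates {V} {k} E T Z =
  ∀ (i j : Fin k) → i F.< j → ∀ (a b : V) → T i a → T j b → ¬ EReach E Z a b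

LinearEdgeCut : {V : Set} {k : ℕ} (E : List (V × V)) → (Fin k → V → Set) → ℕ → Set
LinearEdgeCut E T s = Σ (Subset (length E)) λ Z → ∣ Z ∣ ≤ s × ESeparates E T Z

Disjoint : {n : ℕ} → Subset n → Subset n → Set
Disjoint {n} A B = ∀ (v : Fin n) → v ∈ A → v ∈ B → ⊥

PairwiseDisjoint : {n k : ℕ} → (Fin k → Subset n) → Set
PairwiseDisjoint {n} {k} T = ∀ (i j : Fin k) → i ≢ j → Disjoint (T i) (T j)

data V' {n k : ℕ} (T : Fin k → Subset n) : Set where
  vin   : Fin n → V' T
  vout  : Fin n → V' T
  vprime : (i : Fin k) (v : Fin n) → v ∈ T i → V' T

module _ {n k : ℕ} (T : Fin k → Subset n) (s : ℕ) where

  primeEdges : Fin k → Fin n → List (V' T × V' T)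
  primeEdges i v with v ∈? T i
  ... | yes p = replicate (suc s) (vprime i v p , vin v) ++ replicate (suc s) (vout v , vprime i v p)
  ... | no _  = []

  D'edges : List (Fin n × Fin n) → List (V' T × V' T)
  D'edges E =
       map (λ v → (vin v , vout v)) (allFin n)
    ++ concatMap (λ { (u , v) → replicate (suc s) (vout u , vin v) }) E
    ++ concatMap (λ i → concatMap (λ v → primeEdges i v) (allFin n)) (allFin k)

  T' : Fin k → V' T → Set
  T' i x = ∃[ v ] Σ (v ∈ T i) λ p → x ≡ vprime i v p

module Submission where

-- Every vertex v of D becomes a "split edge" v_in → v_out of D'; all other
-- edges of D' ("link edges") come in s+1 parallel copies, so a cut of size
-- at most s can never destroy a link: some copy always survives.
--
-- (⇒) Given a vertex cut Z, delete the split edges of the vertices of Z.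
--     An edge walk of D' ending in a terminal b' projects, by induction on
--     the walk, to a walk of D \ Z ending in b (or is the trivial walk from
--     b' itself, which disjointness of the T_i rules out for i < j).
-- (⇐) Given an edge cut Z', let Z be the tails of the deleted split edges;
--     then |Z| ≤ |Z'| and every walk of D \ Z lifts to D' \ Z'.

open import Defs
open import Data.Nat using (ℕ; zero; suc; _≤_; _+_; z≤n; s≤s)
open import Data.Nat.Properties using (≤-trans; ≤-reflexive; +-mono-≤; +-monoʳ-≤; n≤1+n; +-suc; +-identityʳ)
open import Data.Fin using (Fin)
import Data.Fin as F
open import Data.Fin.Properties using (<⇒≢)
open import Data.Fin.Subset using (Subset; _∈_; _∉_; _⊆_; ∣_∣; inside; outside; ⁅_⁆; _∪_) renaming (⊥ to ∅)
open import Data.Fin.Subset.Properties using (_∈?_; x∈⁅x⁆; ∣⁅x⁆∣≡1; ∣⊥∣≡0; x∈p∪q⁺; ∣p∣≤∣x∷p∣)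
open import Data.List using (List; []; _∷_; _++_; map; concatMap; replicate; length; lookup; allFin)
import Data.List as L
open import Data.List.Relation.Unary.All using (All)
import Data.List.Relation.Unary.All as All
open import Data.List.Relation.Unary.All.Properties using (++⁺; concat⁺; map⁺; replicate⁺)
import Data.List.Relation.Unary.Any as Any
open import Data.List.Relation.Unary.Any.Properties using (lookup-index)
open import Data.List.Membership.Propositional using () renaming (_∈_ to _∈ₗ_)
open import Data.List.Membership.Propositional.Properties using (∈-lookup; ∈-allFin; ∈-++⁺ˡ; ∈-map⁺)
import Data.Vec as V
open import Data.Vec using ([]; _∷_; here; there)
open import Data.Vec.Properties using ([]=⇒lookup; tabulate∘lookup)
open import Data.Vec.Properties.WithK using ([]=-irrelevant)
open import Data.Bool using (Bool; true; false)
open import Data.Product using (Σ; ∃-syntax; _×_; _,_)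
open import Data.Sum using (_⊎_; inj₁; inj₂)
open import Data.Empty using (⊥-elim)
open import Relation.Binary.PropositionalEquality using (_≡_; refl; sym; trans; cong; cong₂; subst; module ≡-Reasoning)
open import Relation.Nullary using (yes; no)
open import Function using (id; _∘_)
open import Function.Bundles using (_⇔_; mk⇔)

-- AtLeast P xs m: at least m entries of xs satisfy P (entries counted with
-- multiplicity, i.e. by position).  Parallel edges are counted this way.
data AtLeast {X : Set} (P : X → Set) : List X → ℕ → Set where
  none : ∀ {xs} → AtLeast P xs 0
  keep : ∀ {x xs m} → P x → AtLeast P xs m → AtLeast P (x ∷ xs) (suc m)
  skip : ∀ {x xs m} → AtLeast P xs m → AtLeast P (x ∷ xs) m

module _ {X : Set} {P : X → Set} where

  survivor-suc : ∀ {x xs b} {Z : Subset (length xs)} →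
    ∃[ e ] e ∉ Z × P (lookup xs e) → ∃[ e ] e ∉ (b ∷ Z) × P (lookup (x ∷ xs) e)
  survivor-suc (e , e∉Z , pe) = F.suc e , (λ { (there e∈Z) → e∉Z e∈Z }) , pe

  survivor : ∀ {xs m} → AtLeast P xs (suc m) → (Z : Subset (length xs)) → ∣ Z ∣ ≤ m →
    ∃[ e ] e ∉ Z × P (lookup xs e)
  survivor (keep px _) (outside ∷ Z) _ = F.zero , (λ ()) , px
  survivor (keep _ occ) (inside ∷ Z) (s≤s ∣Z∣≤m) = survivor-suc (survivor occ Z ∣Z∣≤m)
  survivor (skip occ) (b ∷ Z) ∣bZ∣≤m =
    survivor-suc (survivor occ Z (≤-trans (∣p∣≤∣x∷p∣ b Z) ∣bZ∣≤m))

  atLeast-++ˡ : ∀ {xs} ys {m} → AtLeast P xs m → AtLeast P (xs ++ ys) m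
  atLeast-++ˡ ys none = none
  atLeast-++ˡ ys (keep px occ) = keep px (atLeast-++ˡ ys occ)
  atLeast-++ˡ ys (skip occ) = skip (atLeast-++ˡ ys occ)

  atLeast-++ʳ : ∀ xs {ys m} → AtLeast P ys m → AtLeast P (xs ++ ys) m
  atLeast-++ʳ [] occ = occ
  atLeast-++ʳ (x ∷ xs) occ = skip (atLeast-++ʳ xs occ)

  atLeast-replicate : ∀ {x} → P x → ∀ m → AtLeast P (replicate m x) m
  atLeast-replicate px zero = none
  atLeast-replicate px (suc m) = keep px (atLeast-replicate px m)

  atLeast-concatMap : ∀ {Y : Set} (f : Y → List X) {y ys m} → y ∈ₗ ys →
    AtLeast P (f y) m → AtLeast P (concatMap f ys) m
  atLeast-concatMap f {ys = y ∷ ys} (Any.here refl) occ = atLeast-++ˡ (concatMap f ys) occ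
  atLeast-concatMap f {ys = y ∷ ys} (Any.there y∈ys) occ = atLeast-++ʳ (f y) (atLeast-concatMap f y∈ys occ)

module _ {X : Set} (p : X → Bool) where

  positions : (xs : List X) → Subset (length xs)
  positions [] = []
  positions (x ∷ xs) = p x ∷ positions xs

  positions-∈ : ∀ xs (e : Fin (length xs)) → p (lookup xs e) ≡ true → e ∈ positions xs
  positions-∈ (x ∷ xs) F.zero px rewrite px = here
  positions-∈ (x ∷ xs) (F.suc e) pe = there (positions-∈ xs e pe)

  positions-++ : ∀ xs ys → ∣ positions (xs ++ ys) ∣ ≡ ∣ positions xs ∣ + ∣ positions ys ∣
  positions-++ [] ys = refl
  positions-++ (x ∷ xs) ys with p x
  ... | true = cong suc (positions-++ xs ys)
  ... | false = positions-++ xs ys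

  positions-none : ∀ {xs} → All (λ x → p x ≡ false) xs → ∣ positions xs ∣ ≡ 0
  positions-none All.[] = refl
  positions-none (px All.∷ pxs) rewrite px = positions-none pxs

positions-mapTabulate : ∀ {X Y : Set} (p : X → Bool) (g : Y → X) {m} (f : Fin m → Y) →
  ∣ positions p (map g (L.tabulate f)) ∣ ≡ ∣ V.tabulate (p ∘ g ∘ f) ∣
positions-mapTabulate p g {zero} f = refl
positions-mapTabulate p g {suc m} f with p (g (f F.zero))
... | true = cong suc (positions-mapTabulate p g (f ∘ F.suc))
... | false = positions-mapTabulate p g (f ∘ F.suc)

∣p∪q∣≤∣p∣+∣q∣ : ∀ {m} (p q : Subset m) → ∣ p ∪ q ∣ ≤ ∣ p ∣ + ∣ q ∣
∣p∪q∣≤∣p∣+∣q∣ [] [] = z≤n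
∣p∪q∣≤∣p∣+∣q∣ (inside ∷ p) (inside ∷ q) =
  s≤s (≤-trans (∣p∪q∣≤∣p∣+∣q∣ p q) (+-monoʳ-≤ ∣ p ∣ (n≤1+n _)))
∣p∪q∣≤∣p∣+∣q∣ (inside ∷ p) (outside ∷ q) = s≤s (∣p∪q∣≤∣p∣+∣q∣ p q)
∣p∪q∣≤∣p∣+∣q∣ (outside ∷ p) (inside ∷ q) =
  ≤-trans (s≤s (∣p∪q∣≤∣p∣+∣q∣ p q)) (≤-reflexive (sym (+-suc ∣ p ∣ ∣ q ∣)))
∣p∪q∣≤∣p∣+∣q∣ (outside ∷ p) (outside ∷ q) = ∣p∪q∣≤∣p∣+∣q∣ p q

module _ {X : Set} {n : ℕ} (h : X → Subset n) where

  collect : (xs : List X) → Subset (length xs) → Subset n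
  collect [] [] = ∅
  collect (x ∷ xs) (outside ∷ Z) = collect xs Z
  collect (x ∷ xs) (inside ∷ Z) = h x ∪ collect xs Z

  collect-card : (∀ x → ∣ h x ∣ ≤ 1) → ∀ xs Z → ∣ collect xs Z ∣ ≤ ∣ Z ∣
  collect-card small [] [] = ≤-reflexive (∣⊥∣≡0 n)
  collect-card small (x ∷ xs) (outside ∷ Z) = collect-card small xs Z
  collect-card small (x ∷ xs) (inside ∷ Z) =
    ≤-trans (∣p∪q∣≤∣p∣+∣q∣ (h x) (collect xs Z)) (+-mono-≤ (small x) (collect-card small xs Z))

  collect-⊇ : ∀ xs Z (e : Fin (length xs)) → e ∈ Z → h (lookup xs e) ⊆ collect xs Z
  collect-⊇ (x ∷ xs) (inside ∷ Z) F.zero here v∈ = x∈p∪q⁺ (inj₁ v∈)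
  collect-⊇ (x ∷ xs) (inside ∷ Z) (F.suc e) (there e∈Z) v∈ = x∈p∪q⁺ (inj₂ (collect-⊇ xs Z e e∈Z v∈))
  collect-⊇ (x ∷ xs) (outside ∷ Z) (F.suc e) (there e∈Z) v∈ = collect-⊇ xs Z e e∈Z v∈

ereach-trans : ∀ {V : Set} {Es : List (V × V)} {Z} {a b c} →
  EReach Es Z a b → EReach Es Z b c → EReach Es Z a c
ereach-trans here r = r
ereach-trans (step e e∉Z eq r) r′ = step e e∉Z eq (ereach-trans r r′)

module Construction {n k : ℕ} (E : List (Fin n × Fin n)) (T : Fin k → Subset n) (s : ℕ) where

  Vertex : Set
  Vertex = V' T

  E' : List (Vertex × Vertex)
  E' = D'edges T s E

  splitEdge : Fin n → Vertex × Vertex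
  splitEdge v = (vin v , vout v)

  splitEdges : List (Vertex × Vertex)
  splitEdges = map splitEdge (allFin n)

  data Link : Vertex × Vertex → Set where
    arc   : ∀ {u w} → (u , w) ∈ₗ E → Link (vout u , vin w)
    enter : ∀ i v p → Link (vprime i v p , vin v)
    leave : ∀ i v p → Link (vout v , vprime i v p)

  data Edge : Vertex × Vertex → Set where
    split : ∀ v → Edge (splitEdge v)
    link  : ∀ {x} → Link x → Edge x

  primeLinks : ∀ i v → All Link (primeEdges T s i v)
  primeLinks i v with v ∈? T i
  ... | yes p = ++⁺ (replicate⁺ (suc s) (enter i v p)) (replicate⁺ (suc s) (leave i v p))
  ... | no _ = All.[]

  D'-shape : Σ (List (Vertex × Vertex)) λ links → E' ≡ splitEdges ++ links × All Link links
  D'-shape = _ , refl , ++⁺ {xs = concatMap _ E}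
    (concat⁺ (map⁺ {xs = E} (All.tabulate λ { {u , w} uw∈E → replicate⁺ (suc s) (arc uw∈E) })))
    (concat⁺ (map⁺ {xs = allFin k} (All.tabulate λ {i} _ →
      concat⁺ (map⁺ {xs = allFin n} (All.tabulate λ {v} _ → primeLinks i v)))))

  edgeKind : ∀ e → Edge (lookup E' e)
  edgeKind e with D'-shape
  ... | _ , shape , links =
    All.lookup (subst (All Edge) (sym shape) (++⁺ splits (All.map link links))) (∈-lookup e)
    where
    splits : All Edge splitEdges
    splits = map⁺ (All.tabulate λ {v} _ → split v)

  -- Every split edge is present (once; but once is all the lifting needs).
  splitEdge∈ : ∀ v → splitEdge v ∈ₗ E'
  splitEdge∈ v = ∈-++⁺ˡ (∈-map⁺ splitEdge (∈-allFin v))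

  arcCopies : ∀ {u w} → (u , w) ∈ₗ E → AtLeast (_≡ (vout u , vin w)) E' (suc s)
  arcCopies uw∈E =
    atLeast-++ʳ splitEdges (atLeast-++ˡ _ (atLeast-concatMap _ uw∈E (atLeast-replicate refl (suc s))))

  primeCopies : ∀ {P : Vertex × Vertex → Set} i v →
    AtLeast P (primeEdges T s i v) (suc s) → AtLeast P E' (suc s)
  primeCopies i v occ = atLeast-++ʳ splitEdges (atLeast-++ʳ _
    (atLeast-concatMap _ (∈-allFin i) (atLeast-concatMap _ (∈-allFin v) occ)))

  enterInBlock : ∀ i v p → AtLeast (_≡ (vprime i v p , vin v)) (primeEdges T s i v) (suc s)
  enterInBlock i v p with v ∈? T i
  ... | yes p′ rewrite []=-irrelevant p′ p = atLeast-++ˡ _ (atLeast-replicate refl (suc s))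
  ... | no p∉ = ⊥-elim (p∉ p)

  leaveInBlock : ∀ i v p → AtLeast (_≡ (vout v , vprime i v p)) (primeEdges T s i v) (suc s)
  leaveInBlock i v p with v ∈? T i
  ... | yes p′ rewrite []=-irrelevant p′ p =
    atLeast-++ʳ (replicate (suc s) _) (atLeast-replicate refl (suc s))
  ... | no p∉ = ⊥-elim (p∉ p)

  cutsSplitOf : Subset n → Vertex × Vertex → Bool
  cutsSplitOf Z (vin u , _) = V.lookup Z u
  cutsSplitOf Z (vout _ , _) = false
  cutsSplitOf Z (vprime _ _ _ , _) = false

  link-uncut : ∀ Z {x} → Link x → cutsSplitOf Z x ≡ false
  link-uncut Z (arc _) = refl
  link-uncut Z (enter _ _ _) = refl
  link-uncut Z (leave _ _ _) = refl

  edgeCut : Subset n → Subset (length E')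
  edgeCut Z = positions (cutsSplitOf Z) E'

  edgeCut-card : ∀ Z → ∣ edgeCut Z ∣ ≡ ∣ Z ∣
  edgeCut-card Z with D'-shape
  ... | links , shape , linkKinds = begin
    ∣ positions cut E' ∣                                        ≡⟨ cong (∣_∣ ∘ positions cut) shape ⟩
    ∣ positions cut (splitEdges ++ links) ∣                     ≡⟨ positions-++ cut splitEdges links ⟩
    ∣ positions cut splitEdges ∣ + ∣ positions cut links ∣      ≡⟨ cong₂ _+_ splitCount linkCount ⟩
    ∣ Z ∣ + 0                                                   ≡⟨ +-identityʳ ∣ Z ∣ ⟩
    ∣ Z ∣                                                       ∎
    where
    open ≡-Reasoning
    cut : Vertex × Vertex → Bool
    cut = cutsSplitOf Z
    splitCount : ∣ positions cut splitEdges ∣ ≡ ∣ Z ∣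
    splitCount = trans (positions-mapTabulate cut splitEdge id) (cong ∣_∣ (tabulate∘lookup Z))
    linkCount : ∣ positions cut links ∣ ≡ 0
    linkCount = positions-none cut (All.map (link-uncut Z) linkKinds)

  module Project (Z : Subset n) (b : Fin n) where

    -- What an edge walk of D' \ edgeCut Z from x to a terminal b′ yields in D \ Z.
    Projection : Vertex → Set
    Projection (vin u) = VReach E Z u b
    Projection (vout u) = u ∉ Z → VReach E Z u b
    Projection (vprime _ v _) = v ≡ b ⊎ VReach E Z v b

    project : ∀ {x j q} → EReach E' (edgeCut Z) x (vprime j b q) → Projection x
    project here = inj₁ refl
    project (step e e∉cut eq r) with subst Edge eq (edgeKind e)
    ... | split u = project r (λ u∈Z → e∉cut (positions-∈ (cutsSplitOf Z) E' e
                                              (trans (cong (cutsSplitOf Z) eq) ([]=⇒lookup u∈Z))))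
    ... | link (arc uw∈E) = λ u∉Z → step u∉Z uw∈E (project r)
    ... | link (enter _ _ _) = inj₂ (project r)
    ... | link (leave _ v _) = λ v∉Z → leaveTo v∉Z (project r)
      where
      leaveTo : v ∉ Z → v ≡ b ⊎ VReach E Z v b → VReach E Z v b
      leaveTo v∉Z (inj₁ refl) = here v∉Z
      leaveTo v∉Z (inj₂ w) = w

  vertexCut⇒edgeCut : PairwiseDisjoint T → LinearVertexCut E T s → LinearEdgeCut E' (T' T s) s
  vertexCut⇒edgeCut disjoint (Z , ∣Z∣≤s , separates) =
    edgeCut Z , subst (_≤ s) (sym (edgeCut-card Z)) ∣Z∣≤s , separates′
    where
    separates′ : ESeparates E' (T' T s) (edgeCut Z)
    separates′ i j i<j _ _ (a , a∈Tᵢ , refl) (b , b∈Tⱼ , refl) walk with Project.project Z b walk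
    ... | inj₁ refl = disjoint i j (<⇒≢ i<j) a a∈Tᵢ b∈Tⱼ
    ... | inj₂ reach = separates i j i<j a b a∈Tᵢ b∈Tⱼ reach

  splitTail : Vertex × Vertex → Subset n
  splitTail (vin u , _) = ⁅ u ⁆
  splitTail (vout _ , _) = ∅
  splitTail (vprime _ _ _ , _) = ∅

  ∣∅∣≤1 : ∣ ∅ {n} ∣ ≤ 1
  ∣∅∣≤1 = ≤-trans (≤-reflexive (∣⊥∣≡0 n)) z≤n

  splitTail-card : ∀ x → ∣ splitTail x ∣ ≤ 1
  splitTail-card (vin u , _) = ≤-reflexive (∣⁅x⁆∣≡1 u)
  splitTail-card (vout _ , _) = ∣∅∣≤1
  splitTail-card (vprime _ _ _ , _) = ∣∅∣≤1

  vertexCut : Subset (length E') → Subset n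
  vertexCut = collect splitTail E'

  module Lift (Z′ : Subset (length E')) (∣Z′∣≤s : ∣ Z′ ∣ ≤ s) where

    viaCopies : ∀ {x y c} → AtLeast (_≡ (x , y)) E' (suc s) → EReach E' Z′ y c → EReach E' Z′ x c
    viaCopies copies r with survivor copies Z′ ∣Z′∣≤s
    ... | e , e∉Z′ , eq = step e e∉Z′ eq r

    viaSplit : ∀ {u c} → u ∉ vertexCut Z′ → EReach E' Z′ (vout u) c → EReach E' Z′ (vin u) c
    viaSplit {u} u∉Z r = step e e∉Z′ (sym (lookup-index (splitEdge∈ u))) r
      where
      e : Fin (length E')
      e = Any.index (splitEdge∈ u)
      e∉Z′ : e ∉ Z′
      e∉Z′ e∈Z′ = u∉Z (collect-⊇ splitTail E' Z′ e e∈Z′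
        (subst (λ x → u ∈ splitTail x) (lookup-index (splitEdge∈ u)) (x∈⁅x⁆ u)))

    lift : ∀ {u b} → VReach E (vertexCut Z′) u b → EReach E' Z′ (vin u) (vout b)
    lift (here u∉Z) = viaSplit u∉Z here
    lift (step u∉Z uw∈E r) = viaSplit u∉Z (viaCopies (arcCopies uw∈E) (lift r))

  -- (⇐) A walk T_i ∋ a ⇝ b ∈ T_j avoiding vertexCut Z′ gives the walk
  -- a′ → a_in ⇝ b_out → b′ avoiding Z′.
  edgeCut⇒vertexCut : LinearEdgeCut E' (T' T s) s → LinearVertexCut E T s
  edgeCut⇒vertexCut (Z′ , ∣Z′∣≤s , separates′) =
    vertexCut Z′ , ≤-trans (collect-card splitTail splitTail-card E' Z′) ∣Z′∣≤s , separates
    where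
    open Lift Z′ ∣Z′∣≤s
    separates : VSeparates E T (vertexCut Z′)
    separates i j i<j a b a∈Tᵢ b∈Tⱼ reach =
      separates′ i j i<j _ _ (a , a∈Tᵢ , refl) (b , b∈Tⱼ , refl)
        (viaCopies (primeCopies i a (enterInBlock i a a∈Tᵢ))
          (ereach-trans (lift reach) (viaCopies (primeCopies j b (leaveInBlock j b b∈Tⱼ)) here)))

mainTheorem5 : {n k : ℕ} (E : List (Fin n × Fin n)) (T : Fin k → Subset n) (s : ℕ) →
    PairwiseDisjoint T →
    LinearVertexCut E T s ⇔ LinearEdgeCut (D'edges T s E) (T' T s) s
mainTheorem5 E T s disjoint = mk⇔ (vertexCut⇒edgeCut disjoint) edgeCut⇒vertexCut
  where open Construction E T s
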